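{- Let $\mathcal{A}$ be an $\mathrm{Inf}$-TELA with $n$ states and $k$ colours, and let $\mathcal{B}$ be the Büchi automaton constructed from $\mathcal{A}$ as described in the context. Then the number of states of $\mathcal{B}$ is in $O\big(\binom{k}{\lfloor k/2\rfloor}^n\cdot\mathrm{tight}(n+1)\big)$, which (using the known estimate $\mathrm{tight}(n)\approx(0.76n)^n$) is $O\big(n\cdot(\binom{k}{\lfloor k/2\rfloor}\cdot0.76n)^n\big)\subseteq O\big(n(2^k\cdot0.76n)^n\big)$.
   Context: TELA: $\mathcal{A}=(Q,\delta,I,\Gamma,p,\mathit{Acc})$ with finite states $Q$, transitions $\delta\subseteq Q\times\Sigma\times Q$, initial states $I$, colours $\Gamma=\{0,\dots,k-1\}$, colouring $p:\delta\to2^\Gamma$, acceptance formula $\mathit{Acc}$ built from $\mathit{true},\mathit{false},\mathrm{Inf}(c),\mathrm{Fin}(c)$ by $\wedge,\vee$; an $\mathrm{Inf}$-TELA has no $\mathrm{Fin}$ atoms. $\delta(S,a)=\{q'\mid\exists q\in S:(q,a,q')\in\delta\}$. $\overline{\mathit{Acc}}$: negation of $\mathit{Acc}$ in negation normal form with each $\neg\mathrm{Inf}(c)$ written as the variable $c$; $\mathrm{Min}$: the (assumed nonempty) set of $\subseteq$-minimal sets $M\subseteq\Gamma$ satisfying $\overline{\mathit{Acc}}$; $\mathrm{lex}$: its lexicographically smallest element. $\lfloor k\rfloor_{\mathrm{even}}$: largest even number $\le k$. $\mathrm{tight}(n)$: number of functions $f:\{1,\dots,n\}\to\omega$ whose maximum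 $r$ is odd and whose image contains $\{1,3,\dots,r\}$. Construction of $\mathcal{B}$ (with $n=|Q|$): level rankings $f:Q\to\{0,\dots,2n\}$, $\mathrm{rank}(f)=\max f$; level models $\mu:Q\to\mathrm{Min}$, consistent w.r.t. $f$ if $\mu(q)=\mathrm{lex}$ whenever $f(q)$ even; $f$ is $(S,\mu)$-tight if $\mathrm{rank}(f)=r$ odd, $f(S)\supseteq\{1,3,\dots,r\}$, $f(Q\setminus S)=\{0\}$, $\mu$ consistent w.r.t. $f$; $\mathcal{T}$: the $f$ that are $(Q,\mu)$-tight for some $\mu$. $(f,\mu)\to_a(f',\mu')$ iff $\mu,\mu'$ consistent w.r.t. $f,f'$ and for all $q$, $q'\in\delta(q,a)$: $f'(q')\le f(q)$; if $p((q,a,q'))\cap\mu(q)\neq\emptyset$ then $f'(q')\le\lfloor f(q)\rfloor_{\mathrm{even}}$; if $\mu'(q')\ne\mu(q)$ then $f'(q')\le\lfloor f(q)\rfloor_{\mathrm{even}}$. $\mathcal{B}$ has states $2^Q\cup Q_2$, $Q_2$ = tuples $(S,O,f,i,\mu)$ with $f\in\mathcal{T}$ $(S,\mu)$-tight, $i\in\{0,2,\dots,2n-2\}$, $O\subseteq S\cap f^{ -1}(i)$; initial state $I$; transitions $S\xrightarrow{a}\delta(S,a)$, $S\xrightarrow{a}(\delta(S,a),\emptyset,f,0,\mu)\in Q_2$, and $(S,O,f,i,\mu)\xrightarrow{a}(S',O',f',i',\mu')$ iff $S'=\delta(S,a)$, $(f,\mu)\to_a(f',\mu')$, $\mathrm{rank}(f)=\mathrm{rank}(f')$,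 and either ($O=\emptyset$, $i'=(i+2)\bmod(\mathrm{rank}(f')+1)$, $O'=f'^{ -1}(i')$) or ($O\ne\emptyset$, $i'=i$, $O'=\delta(O,a)\cap f'^{ -1}(i)$); accepting transitions: $\emptyset\xrightarrow{a}\emptyset$ and transitions within $Q_2$ whose source has $O=\emptyset$. -}

module Defs where

open import Data.Nat using (ℕ; zero; suc; _+_; _*_; _≤_; _⊔_)
open import Data.Nat.Base using (⌊_/2⌋)
open import Data.Nat.Combinatorics using (_C_)
open import Data.Bool using (Bool; true; false)
import Data.Fin
open import Data.Fin.Subset using (Subset; _∈_; _∉_; _⊆_; ⊤)
open import Data.Vec using (Vec; []; _∷_; lookup; foldr′)
open import Data.Vec.Relation.Unary.All using (All)
open import Data.List using (List; length)
open import Data.List.Relation.Unary.Unique.Propositional using (Unique)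
import Data.List.Membership.Propositional as LM
open import Data.Product using (Σ; ∃; ∃-syntax; _×_; _,_)
open import Data.Sum using (_⊎_; inj₁; inj₂)
open import Data.Unit using () renaming (⊤ to Unit)
open import Data.Empty using (⊥)
open import Relation.Binary.PropositionalEquality using (_≡_)
open import Data.Nat.Divisibility using (_∣_)
open import Relation.Nullary using (¬_)

Even Odd : ℕ → Set
Even m = 2 ∣ m
Odd m = ¬ (2 ∣ m)

data Formula (k : ℕ) : Set where
  tt ff   : Formula k
  Inf FinA : Data.Fin.Fin k → Formula k
  _∧_ _∨_ : Formula k → Formula k → Formula k

data IsInf {k : ℕ} : Formula k → Set where
  tt  : IsInf tt
  ff  : IsInf ff
  inf : ∀ c → IsInf (Inf c)
  and : ∀ {φ ψ} → IsInf φ → IsInf ψ → IsInf (φ ∧ ψ)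
  or  : ∀ {φ ψ} → IsInf φ → IsInf ψ → IsInf (φ ∨ ψ)

data PForm (k : ℕ) : Set where
  tt ff   : PForm k
  var     : Data.Fin.Fin k → PForm k
  _∧_ _∨_ : PForm k → PForm k → PForm k

-- negation in NNF, ¬Inf(c) written as the variable c
negAcc : ∀ {k} (φ : Formula k) → IsInf φ → PForm k
negAcc tt tt = ff
negAcc ff ff = tt
negAcc (Inf c) (inf .c) = var c
negAcc (φ ∧ ψ) (and p q) = negAcc φ p ∨ negAcc ψ q
negAcc (φ ∨ ψ) (or p q) = negAcc φ p ∧ negAcc ψ q

Sat : ∀ {k} → PForm k → Subset k → Set
Sat tt M = Unit
Sat ff M = ⊥
Sat (var c) M = c ∈ M
Sat (φ ∧ ψ) M = Sat φ M × Sat ψ M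
Sat (φ ∨ ψ) M = Sat φ M ⊎ Sat ψ M

IsMin : ∀ {k} → PForm k → Subset k → Set
IsMin {k} φ M = Sat φ M × (∀ (M' : Subset k) → M' ⊆ M → Sat φ M' → M' ≡ M)

-- lexicographic order on subsets of {0..k-1}, via characteristic vectors:
-- at the first position where they differ, the smaller set contains the element.
data LexLeq : ∀ {k} → Subset k → Subset k → Set where
  []   : LexLeq [] []
  same : ∀ {k} {b} {xs ys : Subset k} → LexLeq xs ys → LexLeq (b ∷ xs) (b ∷ ys)
  lt   : ∀ {k} {xs ys : Subset k} → LexLeq (true ∷ xs) (false ∷ ys)

IsLex : ∀ {k} → PForm k → Subset k → Set
IsLex {k} φ L = IsMin φ L × (∀ (M : Subset k) → IsMin φ M → LexLeq L M)

record InfTELA (n k : ℕ) : Set where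
  field
    s      : ℕ                                  -- alphabet Σ = Fin s
    δ      : Data.Fin.Fin n → Data.Fin.Fin s → Subset n
    I      : Subset n
    p      : Data.Fin.Fin n → Data.Fin.Fin s → Data.Fin.Fin n → Subset k
    Acc    : Formula k
    isInf  : IsInf Acc

negAccOf : ∀ {n k} → InfTELA n k → PForm k
negAccOf A = negAcc (InfTELA.Acc A) (InfTELA.isInf A)

rank : ∀ {n} → Vec ℕ n → ℕ
rank = foldr′ _⊔_ 0

IsLevelRanking : (n : ℕ) → Vec ℕ n → Set
IsLevelRanking n f = All (λ v → v ≤ n + n) f

IsLevelModel : ∀ {n k} → PForm k → Vec (Subset k) n → Set
IsLevelModel φ μ = All (IsMin φ) μ

Consistent : ∀ {n k} → Subset k → Vec ℕ n → Vec (Subset k) n → Set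
Consistent {n} L f μ = ∀ (q : Data.Fin.Fin n) → Even (lookup f q) → lookup μ q ≡ L

IsTightFor : ∀ {n k} → Subset k → Subset n → Vec (Subset k) n → Vec ℕ n → Set
IsTightFor {n} L S μ f =
  Odd (rank f)
  × (∀ j → Odd j → j ≤ rank f → ∃[ q ] (q ∈ S × lookup f q ≡ j))
  × (∀ q → q ∉ S → lookup f q ≡ 0)
  × Consistent L f μ

InT : ∀ {n k} → PForm k → Subset k → Vec ℕ n → Set
InT {n} {k} φ L f =
  IsLevelRanking n f × Σ (Vec (Subset k) n) (λ μ → IsLevelModel φ μ × IsTightFor L ⊤ μ f)

RawState : ℕ → ℕ → Set
RawState n k = Subset n ⊎ (Subset n × Subset n × Vec ℕ n × ℕ × Vec (Subset k) n)

IsStateB : ∀ {n k} → InfTELA n k → Subset k → RawState n k → Set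
IsStateB A L (inj₁ S) = Unit
IsStateB {n} A L (inj₂ (S , O , f , i , μ)) =
  IsLevelModel φ μ
  × InT φ L f
  × IsTightFor L S μ f
  × (Even i × i + 2 ≤ n + n)
  × (∀ q → q ∈ O → q ∈ S × lookup f q ≡ i)
  where φ = negAccOf A

-- Cardinality of the set of elements satisfying P (a duplicate-free
-- list enumerating exactly the elements satisfying P has length m)

record HasCard {A : Set} (P : A → Set) (m : ℕ) : Set where
  field
    xs       : List A
    unique   : Unique xs
    len      : length xs ≡ m
    complete : ∀ x → P x → x LM.∈ xs
    sound    : ∀ x → x LM.∈ xs → P x

IsTightFun : (n : ℕ) → Vec ℕ n → Set
IsTightFun n f = Odd (rank f) × (∀ j → Odd j → j ≤ rank f → ∃[ q ] lookup f q ≡ j)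

NumStatesB : ∀ {n k} → InfTELA n k → Subset k → ℕ → Set
NumStatesB A L m = HasCard (IsStateB A L) m

Tight : ℕ → ℕ → Set
Tight n t = HasCard (IsTightFun n) t

bound : ℕ → ℕ → ℕ → ℕ
bound n k t = ((k C ⌊ k /2⌋) Data.Nat.^ n) * t

-- The level model μ takes values
-- in Min, an antichain of 2^Γ. De Bruijn's symmetric chain decomposition of 2^Γ sends every set to
-- the set of size ⌊k/2⌋ on its chain, and two members of an antichain on one chain coincide, so μ
-- is determined by a word of length n over the middle layer: (k choose ⌊k/2⌋)^n choices. The rest,
-- (S, O, f, i), is coded injectively by a tight function on n + 1 points and one of four flags:
-- shifting the values of f frees the value 1 for the states outside S and i + 1 for the states
-- of O, and the extra point records i; a plain set S is coded by the tight function 1 ∷ χ_S.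
-- Hence ℬ has at most 5 · (k choose ⌊k/2⌋)^n · tight(n + 1) states, for every n.

module Submission where

open import Defs
open import Data.Nat using (ℕ; _+_; _*_; _≤_; _≥_)
open import Data.Product using (∃; ∃-syntax; _×_)
open import Data.Fin.Subset using (Subset)
open import Data.Product using (_,_)

module Enumeration where

  open import Data.Nat using (zero; suc; _^_; z≤n; s≤s)
  open import Data.Nat.Properties using (≤-trans; ≤-reflexive; module ≤-Reasoning)
  open import Data.List using (List; []; _∷_; length; map; _++_; cartesianProduct)
  open import Data.List.Properties using (length-++; length-map; length-removeAt′)
  open import Data.List.Membership.Propositional using (_∈_)
  open import Data.List.Membership.Propositional.Properties using (∈-map⁺; ∈-map⁻; ∈-cartesianProduct⁺)
  open import Data.List.Relation.Binary.Subset.Propositional using (_⊆_)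
  open import Data.List.Relation.Unary.Any using (here; there; _─_)
  open import Data.List.Relation.Unary.All as All using ([]; _∷_)
  open import Data.List.Relation.Unary.Unique.Propositional using (Unique; []; _∷_)
  open import Data.Vec as Vec using (Vec)
  import Data.Vec.Relation.Unary.All as VecAll
  open import Data.Product using (_,_; uncurry)
  open import Relation.Binary.PropositionalEquality
  open import Relation.Nullary using (contradiction)

  private
    ∈-─ : ∀ {A : Set} {x y : A} {ys : List A} (x∈ys : x ∈ ys) → y ∈ ys → y ≢ x → y ∈ (ys ─ x∈ys)
    ∈-─ (here refl) (here refl) y≢x = contradiction refl y≢x
    ∈-─ (here refl) (there y∈ys) _  = y∈ys
    ∈-─ (there _)   (here y≡z)   _  = here y≡z
    ∈-─ (there x∈ys) (there y∈ys) y≢x = there (∈-─ x∈ys y∈ys y≢x)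

  Unique∧⊆⇒length≤ : ∀ {A : Set} {xs ys : List A} → Unique xs → xs ⊆ ys → length xs ≤ length ys
  Unique∧⊆⇒length≤ {xs = []} [] _ = z≤n
  Unique∧⊆⇒length≤ {xs = x ∷ xs} {ys} (x∉xs ∷ uxs) xs⊆ys =
    ≤-trans (s≤s (Unique∧⊆⇒length≤ uxs xs⊆ys─x)) (≤-reflexive (sym (length-removeAt′ ys _)))
    where
    x∈ys = xs⊆ys (here refl)
    xs⊆ys─x : xs ⊆ (ys ─ x∈ys)
    xs⊆ys─x y∈xs = ∈-─ x∈ys (xs⊆ys (there y∈xs)) (λ { refl → All.lookup x∉xs y∈xs refl })

  module _ {A B : Set} (P : A → Set) (f : A → B) (f-inj : ∀ {x y} → P x → P y → f x ≡ f y → x ≡ y) where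

    Unique-map⁺ : ∀ {xs} → Unique xs → All.All P xs → Unique (map f xs)
    Unique-map⁺ [] [] = []
    Unique-map⁺ (x∉xs ∷ uxs) (px ∷ pxs) = distinct px x∉xs pxs ∷ Unique-map⁺ uxs pxs
      where
      distinct : ∀ {x ys} → P x → All.All (x ≢_) ys → All.All P ys → All.All (f x ≢_) (map f ys)
      distinct px [] [] = []
      distinct px (x≢y ∷ x≢ys) (py ∷ pys) = (λ fx≡fy → x≢y (f-inj px py fx≡fy)) ∷ distinct px x≢ys pys

    HasCard-≤-injection : ∀ {m} {ys : List B} → HasCard P m → (∀ x → P x → f x ∈ ys) → m ≤ length ys
    HasCard-≤-injection {m} {ys} card f∈ys = begin
      m                  ≡⟨ sym (HasCard.len card) ⟩
      length xs          ≡⟨ sym (length-map f xs) ⟩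
      length (map f xs)  ≤⟨ Unique∧⊆⇒length≤ unique-image image⊆ys ⟩
      length ys          ∎
      where
      open ≤-Reasoning
      xs = HasCard.xs card
      unique-image : Unique (map f xs)
      unique-image = Unique-map⁺ (HasCard.unique card) (All.tabulate (HasCard.sound card _))
      image⊆ys : map f xs ⊆ ys
      image⊆ys fx∈ with ∈-map⁻ f fx∈
      ... | x , x∈xs , refl = f∈ys x (HasCard.sound card x x∈xs)

  length-cartesianProduct : ∀ {A B : Set} (xs : List A) (ys : List B) →
                            length (cartesianProduct xs ys) ≡ length xs * length ys
  length-cartesianProduct []       ys = refl
  length-cartesianProduct (x ∷ xs) ys = begin
    length (map (x ,_) ys ++ cartesianProduct xs ys)          ≡⟨ length-++ (map (x ,_) ys) ⟩
    length (map (x ,_) ys) + length (cartesianProduct xs ys)  ≡⟨ cong₂ _+_ (length-map (x ,_) ys) (length-cartesianProduct xs ys) ⟩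
    length ys + length xs * length ys                         ∎
    where open ≡-Reasoning

  vectors : ∀ {A : Set} n → List A → List (Vec A n)
  vectors zero    xs = Vec.[] ∷ []
  vectors (suc n) xs = map (uncurry Vec._∷_) (cartesianProduct xs (vectors n xs))

  length-vectors : ∀ {A : Set} n (xs : List A) → length (vectors n xs) ≡ length xs ^ n
  length-vectors zero    xs = refl
  length-vectors (suc n) xs = begin
    length (map (uncurry Vec._∷_) (cartesianProduct xs (vectors n xs)))  ≡⟨ length-map _ (cartesianProduct xs (vectors n xs)) ⟩
    length (cartesianProduct xs (vectors n xs))                          ≡⟨ length-cartesianProduct xs (vectors n xs) ⟩
    length xs * length (vectors n xs)                                    ≡⟨ cong (length xs *_) (length-vectors n xs) ⟩
    length xs * length xs ^ n                                            ∎
    where open ≡-Reasoning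

  ∈-vectors : ∀ {A : Set} {n} {xs : List A} {v : Vec A n} → VecAll.All (_∈ xs) v → v ∈ vectors n xs
  ∈-vectors VecAll.[]        = here refl
  ∈-vectors (x∈xs VecAll.∷ v∈xs) = ∈-map⁺ (uncurry Vec._∷_) (∈-cartesianProduct⁺ x∈xs (∈-vectors v∈xs))


module SymmetricChains where

  open import Data.Nat using (zero; suc; _<_; ⌊_/2⌋)
  import Data.Nat as ℕ
  open import Data.Nat.Properties
    using (≤-refl; ≤-trans; ≤-reflexive; ≤-antisym; ≤-pred; m≤n⇒m≤1+n; <-irrefl; ≤∧≢⇒<; +-suc; +-monoˡ-≤; +-monoʳ-≤;
           ⌊n/2⌋-mono; n≡⌊n+n/2⌋)
  open import Data.Nat.Combinatorics using (_C_; nCk+nC[k+1]≡[n+1]C[k+1])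
  open import Data.Bool using (if_then_else_)
  import Data.Bool.Properties as Bool
  open import Data.Fin.Subset using (_⊆_; ∣_∣; inside; outside)
  open import Data.Fin.Subset.Properties using (⊆-refl; ⊆-trans; s⊆s; out⊆)
  open import Data.List using (List; []; _∷_; length; map; _++_)
  open import Data.List.Properties using (length-++; length-map)
  open import Data.List.NonEmpty using (List⁺; _∷_; head; toList)
  open import Data.List.Membership.Propositional using (_∈_)
  open import Data.List.Membership.Propositional.Properties using (∈-map⁺; ∈-map⁻; ∈-++⁺ˡ; ∈-++⁺ʳ)
  open import Data.List.Relation.Unary.Any using (here; there)
  open import Data.Vec using ([]; _∷_)
  open import Data.Vec.Properties using (≡-dec)
  open import Data.Product using (∃₂; _,_; proj₁; proj₂)
  open import Data.Sum using (_⊎_; inj₁; inj₂)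
  open import Relation.Binary.PropositionalEquality
  open import Relation.Binary.Definitions using (DecidableEquality)
  open import Relation.Nullary using (does; yes; no; contradiction)

  layer : (k j : ℕ) → List (Subset k)
  layer zero    zero    = [] ∷ []
  layer zero    (suc j) = []
  layer (suc k) zero    = map (outside ∷_) (layer k zero)
  layer (suc k) (suc j) = map (inside ∷_) (layer k j) ++ map (outside ∷_) (layer k (suc j))

  length-layer : (k j : ℕ) → length (layer k j) ≡ k C j
  length-layer zero    zero    = refl
  length-layer zero    (suc j) = refl
  length-layer (suc k) zero    = trans (length-map _ (layer k zero)) (length-layer k zero)
  length-layer (suc k) (suc j) = begin
    length (map (inside ∷_) (layer k j) ++ map (outside ∷_) (layer k (suc j)))
      ≡⟨ length-++ (map (inside ∷_) (layer k j)) ⟩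
    length (map (inside ∷_) (layer k j)) + length (map (outside ∷_) (layer k (suc j)))
      ≡⟨ cong₂ _+_ (length-map _ (layer k j)) (length-map _ (layer k (suc j))) ⟩
    length (layer k j) + length (layer k (suc j))
      ≡⟨ cong₂ _+_ (length-layer k j) (length-layer k (suc j)) ⟩
    k C j + k C suc j
      ≡⟨ nCk+nC[k+1]≡[n+1]C[k+1] k j ⟩
    suc k C suc j
      ∎
    where open ≡-Reasoning

  ∈-layer : ∀ {k} (A : Subset k) → A ∈ layer k ∣ A ∣
  ∈-layer []             = here refl
  ∈-layer (inside ∷ A)   = ∈-++⁺ˡ (∈-map⁺ (inside ∷_) (∈-layer A))
  ∈-layer {suc k} (outside ∷ A) with ∣ A ∣ | ∈-layer A
  ... | zero  | A∈ = ∈-map⁺ (outside ∷_) A∈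
  ... | suc j | A∈ = ∈-++⁺ʳ (map (inside ∷_) (layer k j)) (∈-map⁺ (outside ∷_) A∈)

  data Chain {k} : ℕ → ℕ → List (Subset k) → Set where
    single : ∀ {A s} → ∣ A ∣ ≡ s → Chain s s (A ∷ [])
    step   : ∀ {A B L e s} → ∣ A ∣ ≡ suc e → B ⊆ A → Chain e s (B ∷ L) → Chain (suc e) s (A ∷ B ∷ L)

  module _ {k : ℕ} where

    Chain-∣head∣ : ∀ {e s} {A : Subset k} {L} → Chain e s (A ∷ L) → ∣ A ∣ ≡ e
    Chain-∣head∣ (single ∣A∣≡e)   = ∣A∣≡e
    Chain-∣head∣ (step ∣A∣≡e _ _) = ∣A∣≡e

    Chain-bottom≤top : ∀ {e s} {L : List (Subset k)} → Chain e s L → s ≤ e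
    Chain-bottom≤top (single _)   = ≤-refl
    Chain-bottom≤top (step _ _ c) = m≤n⇒m≤1+n (Chain-bottom≤top c)

    Chain-∣tail∣<∣head∣ : ∀ {e s} {A B : Subset k} {L} → Chain e s (A ∷ L) → B ∈ L → ∣ B ∣ < e
    Chain-∣tail∣<∣head∣ (step _ _ c) (here refl) = ≤-reflexive (cong suc (Chain-∣head∣ c))
    Chain-∣tail∣<∣head∣ (step _ _ c) (there B∈L) = m≤n⇒m≤1+n (Chain-∣tail∣<∣head∣ c B∈L)

    Chain-⊆head : ∀ {e s} {A B : Subset k} {L} → Chain e s (A ∷ L) → B ∈ A ∷ L → B ⊆ A
    Chain-⊆head c                (here refl)   = ⊆-refl
    Chain-⊆head (step _ B⊆A c)   (there B∈L)   = ⊆-trans (Chain-⊆head c B∈L) B⊆A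

    Chain-comparable : ∀ {e s} {L : List (Subset k)} → Chain e s L →
                       ∀ {A B} → A ∈ L → B ∈ L → A ⊆ B ⊎ B ⊆ A
    Chain-comparable c            (here refl)  B∈L          = inj₂ (Chain-⊆head c B∈L)
    Chain-comparable c            (there A∈L)  (here refl)  = inj₁ (Chain-⊆head c (there A∈L))
    Chain-comparable (step _ _ c) (there A∈L)  (there B∈L)  = Chain-comparable c A∈L B∈L

    Chain-hits-size : ∀ {e s} {L : List (Subset k)} → Chain e s L →
                      ∀ j → s ≤ j → j ≤ e → ∃ λ A → A ∈ L × ∣ A ∣ ≡ j
    Chain-hits-size (single {A} ∣A∣≡s) j s≤j j≤s = A , here refl , trans ∣A∣≡s (≤-antisym s≤j j≤s)
    Chain-hits-size (step {A} {e = e} ∣A∣≡1+e _ c) j s≤j j≤1+e with j ℕ.≟ suc e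
    ... | yes j≡1+e = A , here refl , trans ∣A∣≡1+e (sym j≡1+e)
    ... | no  j≢1+e with Chain-hits-size c j s≤j (≤-pred (≤∧≢⇒< j≤1+e j≢1+e))
    ...   | B , B∈L , ∣B∣≡j = B , there B∈L , ∣B∣≡j

    Chain-map-outside : ∀ {e s} {L : List (Subset k)} → Chain e s L → Chain e s (map (outside ∷_) L)
    Chain-map-outside (single ∣A∣≡s)     = single ∣A∣≡s
    Chain-map-outside (step ∣A∣≡e B⊆A c) = step ∣A∣≡e (s⊆s B⊆A) (Chain-map-outside c)

    Chain-map-inside : ∀ {e s} {L : List (Subset k)} → Chain e s L → Chain (suc e) (suc s) (map (inside ∷_) L)
    Chain-map-inside (single ∣A∣≡s)     = single (cong suc ∣A∣≡s)
    Chain-map-inside (step ∣A∣≡e B⊆A c) = step (cong suc ∣A∣≡e) (s⊆s B⊆A) (Chain-map-inside c)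

  IsSymmetricChain : ∀ k → List⁺ (Subset k) → Set
  IsSymmetricChain k c = ∃₂ λ e s → Chain e s (toList c) × s + e ≡ k

  _≟ₛ_ : ∀ {k} → DecidableEquality (Subset k)
  _≟ₛ_ = ≡-dec Bool._≟_

  -- de Bruijn's recursion: a symmetric chain A₁ ⊂ ⋯ ⊂ Aₘ of 2^k yields the symmetric chains
  -- 0A₁ ⊂ ⋯ ⊂ 0Aₘ ⊂ 1Aₘ and 1A₁ ⊂ ⋯ ⊂ 1Aₘ₋₁ of 2^(k+1); chains are listed top first.
  lengthen : ∀ {k} → List⁺ (Subset k) → List⁺ (Subset (suc k))
  lengthen (A ∷ L) = (inside ∷ A) ∷ map (outside ∷_) (A ∷ L)

  -- On a one-element chain the second chain is empty; chainOf never takes that junk value.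
  shorten : ∀ {k} → List⁺ (Subset k) → List⁺ (Subset (suc k))
  shorten (A ∷ [])    = lengthen (A ∷ [])
  shorten (A ∷ B ∷ L) = (inside ∷ B) ∷ map (inside ∷_) L

  chainOf : ∀ {k} → Subset k → List⁺ (Subset k)
  chainOf []            = [] ∷ []
  chainOf (outside ∷ A) = lengthen (chainOf A)
  chainOf (inside ∷ A)  = if does (A ≟ₛ head (chainOf A)) then lengthen (chainOf A) else shorten (chainOf A)

  module _ {k : ℕ} where

    lengthen-symmetric : (c : List⁺ (Subset k)) → IsSymmetricChain k c → IsSymmetricChain (suc k) (lengthen c)
    lengthen-symmetric (A ∷ L) (e , s , ch , s+e≡k) =
      suc e , s , step (cong suc (Chain-∣head∣ ch)) (out⊆ ⊆-refl) (Chain-map-outside ch) , trans (+-suc s e) (cong suc s+e≡k)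

    shorten-symmetric : (c : List⁺ (Subset k)) → IsSymmetricChain k c → IsSymmetricChain (suc k) (shorten c)
    shorten-symmetric (A ∷ [])    sym-c = lengthen-symmetric (A ∷ []) sym-c
    shorten-symmetric (A ∷ B ∷ L) (.(suc e) , s , step {e = e} _ _ ch , s+e≡k) =
      suc e , suc s , Chain-map-inside ch , cong suc s+e≡k

  chainOf-symmetric : ∀ {k} (A : Subset k) → IsSymmetricChain k (chainOf A)
  chainOf-symmetric []            = 0 , 0 , single refl , refl
  chainOf-symmetric (outside ∷ A) = lengthen-symmetric (chainOf A) (chainOf-symmetric A)
  chainOf-symmetric (inside ∷ A) with A ≟ₛ head (chainOf A)
  ... | yes _ = lengthen-symmetric (chainOf A) (chainOf-symmetric A)
  ... | no  _ = shorten-symmetric (chainOf A) (chainOf-symmetric A)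

  ∈-shorten : ∀ {k} {A : Subset k} (c : List⁺ (Subset k)) → A ∈ toList c → A ≢ head c → inside ∷ A ∈ toList (shorten c)
  ∈-shorten (B ∷ L)      (here A≡B)  A≢B = contradiction A≡B A≢B
  ∈-shorten (B ∷ C ∷ L)  (there A∈L) _   = ∈-map⁺ (inside ∷_) A∈L

  ∈-chainOf : ∀ {k} (A : Subset k) → A ∈ toList (chainOf A)
  ∈-chainOf []            = here refl
  ∈-chainOf (outside ∷ A) = there (∈-map⁺ (outside ∷_) (∈-chainOf A))
  ∈-chainOf (inside ∷ A) with A ≟ₛ head (chainOf A)
  ... | yes A≡top = here (cong (inside ∷_) A≡top)
  ... | no  A≢top = ∈-shorten (chainOf A) (∈-chainOf A) A≢top

  ClosedChain : ∀ {k} → List⁺ (Subset k) → Set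
  ClosedChain c = ∀ {B} → B ∈ toList c → chainOf B ≡ c

  module _ {k : ℕ} where

    chainOf-inside-top : ∀ {A : Subset k} {c} → chainOf A ≡ c → A ≡ head c → chainOf (inside ∷ A) ≡ lengthen c
    chainOf-inside-top {A} refl A≡top with A ≟ₛ head (chainOf A)
    ... | yes _     = refl
    ... | no  A≢top = contradiction A≡top A≢top

    chainOf-inside-below : ∀ {A : Subset k} {c} → chainOf A ≡ c → A ≢ head c → chainOf (inside ∷ A) ≡ shorten c
    chainOf-inside-below {A} refl A≢top with A ≟ₛ head (chainOf A)
    ... | yes A≡top = contradiction A≡top A≢top
    ... | no  _     = refl

    lengthen-closed : (c : List⁺ (Subset k)) → ClosedChain c → ClosedChain (lengthen c)
    lengthen-closed (A ∷ L) closed (here refl) = chainOf-inside-top (closed (here refl)) refl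
    lengthen-closed (A ∷ L) closed (there B∈) with ∈-map⁻ (outside ∷_) B∈
    ... | B , B∈c , refl = cong lengthen (closed B∈c)

    shorten-closed : (c : List⁺ (Subset k)) → IsSymmetricChain k c → ClosedChain c → ClosedChain (shorten c)
    shorten-closed (A ∷ [])    _                  closed B∈ = lengthen-closed (A ∷ []) closed B∈
    shorten-closed (A ∷ B ∷ L) (_ , _ , ch , _) closed B∈ with ∈-map⁻ (inside ∷_) B∈
    ... | C , C∈ , refl = chainOf-inside-below (closed (there C∈)) C≢A
      where
      C≢A : C ≢ A
      C≢A refl = <-irrefl (Chain-∣head∣ ch) (Chain-∣tail∣<∣head∣ ch C∈)

  chainOf-closed : ∀ {k} (A : Subset k) → ClosedChain (chainOf A)
  chainOf-closed []            (here refl) = refl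
  chainOf-closed (outside ∷ A) = lengthen-closed (chainOf A) (chainOf-closed A)
  chainOf-closed (inside ∷ A) with A ≟ₛ head (chainOf A)
  ... | yes _ = lengthen-closed (chainOf A) (chainOf-closed A)
  ... | no  _ = shorten-closed (chainOf A) (chainOf-symmetric A) (chainOf-closed A)

  ⌊/2⌋-between : ∀ {s e} → s ≤ e → s ≤ ⌊ s + e /2⌋ × ⌊ s + e /2⌋ ≤ e
  ⌊/2⌋-between {s} {e} s≤e =
    ≤-trans (≤-reflexive (n≡⌊n+n/2⌋ s)) (⌊n/2⌋-mono (+-monoʳ-≤ s s≤e)) ,
    ≤-trans (⌊n/2⌋-mono (+-monoˡ-≤ e s≤e)) (≤-reflexive (sym (n≡⌊n+n/2⌋ e)))

  middleOf : ∀ {k} (A : Subset k) → ∃ λ M → M ∈ toList (chainOf A) × ∣ M ∣ ≡ ⌊ k /2⌋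
  middleOf A with chainOf-symmetric A
  ... | e , s , ch , refl = Chain-hits-size ch _ (proj₁ between) (proj₂ between)
    where between = ⌊/2⌋-between (Chain-bottom≤top ch)

  middle : ∀ {k} → Subset k → Subset k
  middle A = proj₁ (middleOf A)

  ∣middle∣ : ∀ {k} (A : Subset k) → ∣ middle A ∣ ≡ ⌊ k /2⌋
  ∣middle∣ A = proj₂ (proj₂ (middleOf A))

  middle-comparable : ∀ {k} (A B : Subset k) → middle A ≡ middle B → A ⊆ B ⊎ B ⊆ A
  middle-comparable A B middleA≡middleB =
    Chain-comparable (proj₁ (proj₂ (proj₂ (chainOf-symmetric A)))) (∈-chainOf A) B∈chainOfA
    where
    same-chain : chainOf B ≡ chainOf A
    same-chain = begin
      chainOf B           ≡⟨ chainOf-closed B (proj₁ (proj₂ (middleOf B))) ⟨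
      chainOf (middle B)  ≡⟨ cong chainOf middleA≡middleB ⟨
      chainOf (middle A)  ≡⟨ chainOf-closed A (proj₁ (proj₂ (middleOf A))) ⟩
      chainOf A           ∎
      where open ≡-Reasoning
    B∈chainOfA : B ∈ toList (chainOf A)
    B∈chainOfA = subst (λ c → B ∈ toList c) same-chain (∈-chainOf B)

  middle∈layer : ∀ {k} (A : Subset k) → middle A ∈ layer k ⌊ k /2⌋
  middle∈layer A = subst (λ j → middle A ∈ layer _ j) (∣middle∣ A) (∈-layer (middle A))


module Parity where

  open import Data.Nat using (zero; suc; ⌊_/2⌋)
  open import Data.Nat.Properties using (+-identityʳ; *-comm; n≡⌊n+n/2⌋)
  open import Data.Nat.Divisibility using (divides; ∣m+n∣m⇒∣n; ∣m∣n⇒∣m+n; ∣-refl; _∣0; ∣1⇒≡1)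
  open import Data.Product using (_,_)
  open import Data.Sum using (_⊎_; inj₁; inj₂)
  open import Relation.Binary.PropositionalEquality
  open import Relation.Nullary using (¬_)

  Even-0 : Even 0
  Even-0 = 2 ∣0

  Even-2 : Even 2
  Even-2 = ∣-refl

  Odd-1 : Odd 1
  Odd-1 2∣1 with ∣1⇒≡1 2∣1
  ... | ()

  Odd⇒≢0 : ∀ {m} → Odd m → m ≢ 0
  Odd⇒≢0 odd refl = odd Even-0

  Odd⇒≢Even : ∀ {m n} → Odd m → Even n → m ≢ n
  Odd⇒≢Even odd even refl = odd even

  Odd-+ˡ : ∀ {d m} → Even d → Odd m → Odd (d + m)
  Odd-+ˡ even-d odd-m 2∣d+m = odd-m (∣m+n∣m⇒∣n 2∣d+m even-d)

  Odd-+ˡ⁻ : ∀ {d m} → Even d → Odd (d + m) → Odd m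
  Odd-+ˡ⁻ even-d odd-d+m 2∣m = odd-d+m (∣m∣n⇒∣m+n even-d 2∣m)

  Even⊎Even-suc : ∀ n → Even n ⊎ Even (suc n)
  Even⊎Even-suc zero    = inj₁ Even-0
  Even⊎Even-suc (suc n) with Even⊎Even-suc n
  ... | inj₁ even-n  = inj₂ (∣m∣n⇒∣m+n Even-2 even-n)
  ... | inj₂ even-1+n = inj₁ even-1+n

  ¬Odd∧Odd-suc : ∀ {m} → Odd m → ¬ Odd (suc m)
  ¬Odd∧Odd-suc {m} odd-m odd-1+m with Even⊎Even-suc m
  ... | inj₁ even-m   = odd-m even-m
  ... | inj₂ even-1+m = odd-1+m even-1+m

  Even⇒double : ∀ {n} → Even n → ∃[ q ] n ≡ q + q
  Even⇒double (divides q n≡q*2) = q , trans n≡q*2 (trans (*-comm q 2) (cong (q +_) (+-identityʳ q)))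

  ⌊/2⌋-injective-Even : ∀ {m n} → Even m → Even n → ⌊ m /2⌋ ≡ ⌊ n /2⌋ → m ≡ n
  ⌊/2⌋-injective-Even even-m even-n eq with Even⇒double even-m | Even⇒double even-n
  ... | p , refl | q , refl = cong (λ x → x + x) (trans (n≡⌊n+n/2⌋ p) (trans eq (sym (n≡⌊n+n/2⌋ q))))


module TightFunctions where

  open import Data.Nat using (zero; suc; _<_; z≤n; _⊔_; pred)
  open import Data.Nat.Properties using (≤-refl; ≤-trans; ≤-antisym; <-irrefl; m≤m⊔n; m≤n⊔m; ⊔-lub)
  open import Data.Fin using (Fin; zero; suc; punchIn; punchOut)
  import Data.Fin as Fin
  open import Data.Fin.Properties using (punchIn-punchOut) renaming (_≟_ to _≟ᶠ_)
  open import Data.Vec using (Vec; []; _∷_; lookup; insertAt; removeAt; cast)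
  open import Data.Vec.Properties
    using (tabulate∘lookup; tabulate-cong; insertAt-lookup; insertAt-punchIn; removeAt-insertAt; lookup-cast; cast-sym)
  open import Data.Product using (_,_)
  open import Data.Sum using (_⊎_; inj₁; inj₂)
  open import Relation.Binary.PropositionalEquality
  open import Relation.Nullary using (yes; no; contradiction)
  open Parity

  lookup≤rank : ∀ {n} (v : Vec ℕ n) q → lookup v q ≤ rank v
  lookup≤rank (x ∷ v) zero    = m≤m⊔n x (rank v)
  lookup≤rank (x ∷ v) (suc q) = ≤-trans (lookup≤rank v q) (m≤n⊔m x (rank v))

  rank-lub : ∀ {n m} (v : Vec ℕ n) → (∀ q → lookup v q ≤ m) → rank v ≤ m
  rank-lub []      _     = z≤n
  rank-lub (x ∷ v) v≤m = ⊔-lub (v≤m zero) (rank-lub v (λ q → v≤m (suc q)))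

  rank-attained : ∀ {n m} (v : Vec ℕ n) → (∀ q → lookup v q ≤ m) → ∃[ q ] lookup v q ≡ m → rank v ≡ m
  rank-attained v v≤m (q , vq≡m) = ≤-antisym (rank-lub v v≤m) (subst (_≤ rank v) vq≡m (lookup≤rank v q))

  module _ {A : Set} {n : ℕ} (h : Vec A n) (p : Fin (suc n)) (x : A) where

    lookup-insertAt-cases : ∀ k → lookup (insertAt h p x) k ≡ x ⊎ ∃[ q ] lookup (insertAt h p x) k ≡ lookup h q
    lookup-insertAt-cases k with p ≟ᶠ k
    ... | yes refl = inj₁ (insertAt-lookup h p x)
    ... | no  p≢k  = inj₂ (punchOut p≢k , trans (cong (lookup (insertAt h p x)) (sym (punchIn-punchOut p≢k)))
                                                (insertAt-punchIn h p x (punchOut p≢k)))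

  module _ {n : ℕ} (h : Vec ℕ n) (p : Fin (suc n)) where

    insertAt-≤ : ∀ {x m} → x ≤ m → (∀ q → lookup h q ≤ m) → ∀ k → lookup (insertAt h p x) k ≤ m
    insertAt-≤ {x} x≤m h≤m k with lookup-insertAt-cases h p x k
    ... | inj₁ eq       = subst (_≤ _) (sym eq) x≤m
    ... | inj₂ (q , eq) = subst (_≤ _) (sym eq) (h≤m q)

    rank-insertAt-max : ∀ x → (∀ q → lookup h q ≤ x) → rank (insertAt h p x) ≡ x
    rank-insertAt-max x h≤x = rank-attained (insertAt h p x) (insertAt-≤ ≤-refl h≤x) (p , insertAt-lookup h p x)

    insertAt-tight : ∀ x m → Odd m → x ≤ m → (∀ q → lookup h q ≤ m) →
                     (∀ j → Odd j → j ≤ m → j ≡ x ⊎ ∃[ q ] lookup h q ≡ j) →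
                     IsTightFun (suc n) (insertAt h p x)
    insertAt-tight x m odd-m x≤m h≤m covered = subst Odd (sym rank≡m) odd-m , λ j odd-j j≤r → hit j odd-j (subst (j ≤_) rank≡m j≤r)
      where
      g = insertAt h p x
      hit : ∀ j → Odd j → j ≤ m → ∃[ k ] lookup g k ≡ j
      hit j odd-j j≤m with covered j odd-j j≤m
      ... | inj₁ refl       = p , insertAt-lookup h p x
      ... | inj₂ (q , hq≡j) = punchIn p q , trans (insertAt-punchIn h p x q) hq≡j
      rank≡m : rank g ≡ m
      rank≡m = rank-attained g (insertAt-≤ x≤m h≤m) (hit m odd-m ≤-refl)

  insertAt-injective-max : ∀ {n} (h h′ : Vec ℕ n) p p′ x → (∀ q → lookup h′ q < x) →
                           insertAt h p x ≡ insertAt h′ p′ x → p ≡ p′ × h ≡ h′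
  insertAt-injective-max h h′ p p′ x h′<x eq with p′ ≟ᶠ p
  ... | yes refl = refl , trans (sym (removeAt-insertAt h p x)) (trans (cong (λ g → removeAt g p) eq) (removeAt-insertAt h′ p x))
  ... | no  p′≢p = contradiction (h′<x (punchOut p′≢p)) (λ h′q<x → <-irrefl (sym x≡h′q) h′q<x)
    where
    x≡h′q : x ≡ lookup h′ (punchOut p′≢p)
    x≡h′q = begin
      x                                                  ≡⟨ insertAt-lookup h p x ⟨
      lookup (insertAt h p x) p                          ≡⟨ cong (λ g → lookup g p) eq ⟩
      lookup (insertAt h′ p′ x) p                        ≡⟨ cong (lookup (insertAt h′ p′ x)) (punchIn-punchOut p′≢p) ⟨
      lookup (insertAt h′ p′ x) (punchIn p′ (punchOut p′≢p)) ≡⟨ insertAt-punchIn h′ p′ x (punchOut p′≢p) ⟩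
      lookup h′ (punchOut p′≢p)                          ∎
      where open ≡-Reasoning

  rank-cast : ∀ {m m′} .(eq : m ≡ m′) (g : Vec ℕ m) → rank (cast eq g) ≡ rank g
  rank-cast {m′ = zero}  eq []      = refl
  rank-cast {m′ = suc _} eq (x ∷ g) = cong (x ⊔_) (rank-cast (cong pred eq) g)

  module _ {m m′ : ℕ} .(eq : m ≡ m′) where

    cast-injective : {g g′ : Vec ℕ m} → cast eq g ≡ cast eq g′ → g ≡ g′
    cast-injective {g} {g′} e = trans (sym (cast-sym eq refl)) (cast-sym eq (sym e))

    cast-tight : {g : Vec ℕ m} → IsTightFun m g → IsTightFun m′ (cast eq g)
    cast-tight {g} (odd , covers) = subst Odd (sym (rank-cast eq g)) odd , hit
      where
      hit : ∀ j → Odd j → j ≤ rank (cast eq g) → ∃[ q ] lookup (cast eq g) q ≡ j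
      hit j odd-j j≤r with covers j odd-j (subst (j ≤_) (rank-cast eq g) j≤r)
      ... | q , gq≡j = Fin.cast eq q , trans (lookup-cast eq g q) gq≡j

  lookup-extensionality : ∀ {A : Set} {n} {u v : Vec A n} → (∀ q → lookup u q ≡ lookup v q) → u ≡ v
  lookup-extensionality {u = u} {v} u≗v = trans (sym (tabulate∘lookup u)) (trans (tabulate-cong u≗v) (tabulate∘lookup v))


module RankingCode where

  open import Data.Nat using (zero; suc; _∸_; _<_; _≤?_; _<ᵇ_; z≤n; s≤s; ⌊_/2⌋)
  import Data.Nat as ℕ
  open import Data.Nat.Properties
    using (≤-refl; ≤-trans; ≤-reflexive; ≤-pred; <⇒≤; <⇒≱; ≤∧≢⇒<; ≮⇒≥; ≰⇒>; <-cmp; <-irrefl; 1+n≰n; n≤1+n; m≤m+n; m≤n+m;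
           n≢0⇒n>0; suc-injective; +-assoc; +-comm; +-suc; +-cancelˡ-≡; +-cancelˡ-≤; +-monoʳ-≤; m+[n∸m]≡n;
           <ᵇ⇒<; <⇒<ᵇ; ⌊n/2⌋-mono; n≡⌊n+n/2⌋; module ≤-Reasoning)
  open import Data.Nat.Divisibility using (∣m∣n⇒∣m+n)
  open import Data.Bool using (Bool; true; false; T)
  open import Data.Fin using (Fin; zero; suc; toℕ)
  open import Data.Fin.Properties using (any?)
  open import Data.Fin.Subset using (_∈_; _∉_)
  open import Data.Fin.Subset.Properties using (_∈?_)
  open import Data.Vec using (Vec; lookup; tabulate; insertAt)
  open import Data.Vec.Properties using (lookup∘tabulate; []=⇒lookup; lookup⇒[]=; ∷-injective)
  open import Data.Product using (_,_; proj₁; proj₂)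
  open import Data.Sum using (_⊎_; inj₁; inj₂)
  open import Function using (_∘_)
  open import Relation.Binary.Definitions using (tri<; tri≈; tri>)
  open import Relation.Binary.PropositionalEquality
  open import Relation.Nullary using (¬_; ¬?; does; yes; no; contradiction)
  open Parity
  open TightFunctions

  -- Values above i move up by 2: parities are kept and i + 1 becomes free for the states of O.
  raiseAbove : ℕ → ℕ → ℕ
  raiseAbove i v with v ≤? i
  ... | yes _ = v
  ... | no  _ = 2 + v

  raiseAbove-cases : ∀ i v → (v ≤ i × raiseAbove i v ≡ v) ⊎ (i < v × raiseAbove i v ≡ 2 + v)
  raiseAbove-cases i v with v ≤? i
  ... | yes v≤i = inj₁ (v≤i , refl)
  ... | no  v≰i = inj₂ (≰⇒> v≰i , refl)

  raiseAbove-≤ : ∀ {i v} → v ≤ i → raiseAbove i v ≡ v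
  raiseAbove-≤ {i} {v} v≤i with raiseAbove-cases i v
  ... | inj₁ (_ , eq)   = eq
  ... | inj₂ (i<v , _)  = contradiction v≤i (<⇒≱ i<v)

  raiseAbove-> : ∀ {i v} → i < v → raiseAbove i v ≡ 2 + v
  raiseAbove-> {i} {v} i<v with raiseAbove-cases i v
  ... | inj₁ (v≤i , _)  = contradiction v≤i (<⇒≱ i<v)
  ... | inj₂ (_ , eq)   = eq

  raiseAbove-≤-2+ : ∀ i v → raiseAbove i v ≤ 2 + v
  raiseAbove-≤-2+ i v with raiseAbove-cases i v
  ... | inj₁ (_ , eq) = ≤-trans (≤-reflexive eq) (m≤n+m v 2)
  ... | inj₂ (_ , eq) = ≤-reflexive eq

  raiseAbove-injective : ∀ i {v w} → raiseAbove i v ≡ raiseAbove i w → v ≡ w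
  raiseAbove-injective i {v} {w} eq with raiseAbove-cases i v | raiseAbove-cases i w
  ... | inj₁ (_ , v′≡v)   | inj₁ (_ , w′≡w)   = trans (sym v′≡v) (trans eq w′≡w)
  ... | inj₂ (_ , v′≡2+v) | inj₂ (_ , w′≡2+w) = +-cancelˡ-≡ 2 v w (trans (sym v′≡2+v) (trans eq w′≡2+w))
  ... | inj₁ (v≤i , v′≡v) | inj₂ (i<w , w′≡2+w) =
    contradiction (subst (_≤ i) (trans (sym v′≡v) (trans eq w′≡2+w)) v≤i) (<⇒≱ (≤-trans i<w (m≤n+m w 2)))
  ... | inj₂ (i<v , v′≡2+v) | inj₁ (w≤i , w′≡w) =
    contradiction (subst (_≤ i) (trans (sym w′≡w) (trans (sym eq) v′≡2+v)) w≤i) (<⇒≱ (≤-trans i<v (m≤n+m v 2)))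

  raiseAbove≢suc : ∀ i v → raiseAbove i v ≢ suc i
  raiseAbove≢suc i v eq with raiseAbove-cases i v
  ... | inj₁ (v≤i , v′≡v)   = <-irrefl (trans (sym v′≡v) eq) (s≤s v≤i)
  ... | inj₂ (i<v , v′≡2+v) = 1+n≰n (≤-trans (n≤1+n _) (≤-trans (≤-reflexive (trans (sym v′≡2+v) eq)) i<v))

  -- The entry of a state q: s and o record q ∈ S and q ∈ O, and v = f(q).
  entry : (δ i : ℕ) → Bool → Bool → ℕ → ℕ
  entry δ i _     true  _ = suc (δ + i)
  entry δ i false false _ = 1
  entry δ i true  false v = δ + raiseAbove i v

  Admissible : (δ i : ℕ) → Bool → Bool → ℕ → Set
  Admissible δ i s o v = (o ≡ true → s ≡ true × v ≡ i) × (s ≡ false → v ≡ 0 × δ ≡ 2)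

  private
    level≢raised : ∀ δ i v → suc (δ + i) ≢ δ + raiseAbove i v
    level≢raised δ i v eq = raiseAbove≢suc i v (sym (+-cancelˡ-≡ δ _ _ (trans (+-suc δ i) eq)))

    level≢1 : ∀ {δ} i → δ ≡ 2 → suc (δ + i) ≢ 1
    level≢1 i refl ()

    raised≢1 : ∀ {δ} x → δ ≡ 2 → δ + x ≢ 1
    raised≢1 x refl ()

  entry-injective : ∀ {δ i s o v s′ o′ v′} → Admissible δ i s o v → Admissible δ i s′ o′ v′ →
                    entry δ i s o v ≡ entry δ i s′ o′ v′ → s ≡ s′ × o ≡ o′ × v ≡ v′
  entry-injective {s = false} {o = true} (inO , _) _ _ with () ← proj₁ (inO refl)
  entry-injective {s′ = false} {o′ = true} _ (inO′ , _) _ with () ← proj₁ (inO′ refl)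
  entry-injective {s = true} {o = true} {s′ = true} {o′ = true} (inO , _) (inO′ , _) _ =
    refl , refl , trans (proj₂ (inO refl)) (sym (proj₂ (inO′ refl)))
  entry-injective {s = true} {o = true} {s′ = true} {o′ = false} {v′} _ _ eq = contradiction eq (level≢raised _ _ v′)
  entry-injective {s = true} {o = false} {v} {s′ = true} {o′ = true} _ _ eq = contradiction (sym eq) (level≢raised _ _ v)
  entry-injective {i = i} {s = true} {o = true} {s′ = false} {o′ = false} _ (_ , out′) eq =
    contradiction eq (level≢1 i (proj₂ (out′ refl)))
  entry-injective {i = i} {s = false} {o = false} {s′ = true} {o′ = true} (_ , out) _ eq =
    contradiction (sym eq) (level≢1 i (proj₂ (out refl)))
  entry-injective {δ} {i} {s = true} {o = false} {s′ = true} {o′ = false} _ _ eq =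
    refl , refl , raiseAbove-injective i (+-cancelˡ-≡ δ _ _ eq)
  entry-injective {s = true} {o = false} {s′ = false} {o′ = false} _ (_ , out′) eq =
    contradiction eq (raised≢1 _ (proj₂ (out′ refl)))
  entry-injective {s = false} {o = false} {s′ = true} {o′ = false} (_ , out) _ eq =
    contradiction (sym eq) (raised≢1 _ (proj₂ (out refl)))
  entry-injective {s = false} {o = false} {s′ = false} {o′ = false} (_ , out) (_ , out′) _ =
    refl , refl , trans (proj₁ (out refl)) (sym (proj₁ (out′ refl)))

  entry-≤-below : ∀ δ {i r} s o {v} → i < r → v ≤ r → entry δ i s o v ≤ 2 + δ + r
  entry-≤-below δ _     true  i<r _   = s≤s (≤-trans (+-monoʳ-≤ δ (<⇒≤ i<r)) (n≤1+n _))
  entry-≤-below δ false false _   _   = s≤s z≤n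
  entry-≤-below δ {i} {r} true false {v} _ v≤r = begin
    δ + raiseAbove i v  ≤⟨ +-monoʳ-≤ δ (≤-trans (raiseAbove-≤-2+ i v) (+-monoʳ-≤ 2 v≤r)) ⟩
    δ + (2 + r)         ≡⟨ +-comm δ (2 + r) ⟩
    2 + r + δ           ≡⟨ cong (2 +_) (+-comm r δ) ⟩
    2 + δ + r           ∎
    where open ≤-Reasoning

  entry-≤-above : ∀ δ {i r} s o {v} → Admissible δ i s o v → r < i → v ≤ r → Odd r → entry δ i s o v ≤ δ + r
  entry-≤-above δ _     true  (inO , _) r<i v≤r _ =
    contradiction (≤-trans (≤-reflexive (sym (proj₂ (inO refl)))) v≤r) (<⇒≱ r<i)
  entry-≤-above δ {r = r} false false _ _ _ odd-r = ≤-trans (n≢0⇒n>0 (Odd⇒≢0 odd-r)) (m≤n+m r δ)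
  entry-≤-above δ true false _ r<i v≤r _ =
    +-monoʳ-≤ δ (≤-trans (≤-reflexive (raiseAbove-≤ (≤-trans v≤r (<⇒≤ r<i)))) v≤r)

  entry-member : ∀ δ i {s o} v → s ≡ true → o ≡ false → entry δ i s o v ≡ δ + raiseAbove i v
  entry-member δ i v refl refl = refl

  entry-outside : ∀ δ i {s o} v → s ≡ false → o ≡ false → entry δ i s o v ≡ 1
  entry-outside δ i v refl refl = refl

  ∉⇒lookup≡false : ∀ {n} {S : Subset n} {q} → q ∉ S → lookup S q ≡ false
  ∉⇒lookup≡false {S = S} {q} q∉S with lookup S q in Sq
  ... | false = refl
  ... | true  = contradiction (lookup⇒[]= q S Sq) q∉S

  record Q₂Ranking {n} (S O : Subset n) (f : Vec ℕ n) (i : ℕ) : Set where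
    field
      rank-odd  : Odd (rank f)
      covers    : ∀ j → Odd j → j ≤ rank f → ∃[ q ] (q ∈ S × lookup f q ≡ j)
      outside-0 : ∀ q → q ∉ S → lookup f q ≡ 0
      i-even    : Even i
      i-bound   : i + 2 ≤ n + n
      O-level   : ∀ q → q ∈ O → q ∈ S × lookup f q ≡ i

  hasOutside : ∀ {n} → Subset n → Bool
  hasOutside S = does (any? λ q → ¬? (q ∈? S))

  ∉⇒hasOutside : ∀ {n} {S : Subset n} {q} → q ∉ S → hasOutside S ≡ true
  ∉⇒hasOutside {S = S} {q} q∉S with any? (λ q → ¬? (q ∈? S))
  ... | yes _    = refl
  ... | no  ¬∃∉  = contradiction (q , q∉S) ¬∃∉

  hasOutside⇒∉ : ∀ {n} {S : Subset n} → hasOutside S ≡ true → ∃[ q ] q ∉ S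
  hasOutside⇒∉ {S = S} eq with any? (λ q → ¬? (q ∈? S))
  ... | yes ∃∉ = ∃∉

  -- Shifting everything by 2 when S ≠ Q frees the value 1 for the states outside S.
  offset : Bool → ℕ
  offset false = 0
  offset true  = 2

  offset-cases : ∀ {n} {S : Subset n} d → d ≡ hasOutside S → offset d ≡ 0 ⊎ (offset d ≡ 2 × ∃[ q ] q ∉ S)
  offset-cases false _  = inj₁ refl
  offset-cases true  d≡ = inj₂ (refl , hasOutside⇒∉ (sym d≡))

  Even-offset : ∀ d → Even (offset d)
  Even-offset false = Even-0
  Even-offset true  = Even-2

  entries : ∀ {n} → ℕ → ℕ → Subset n → Subset n → Vec ℕ n → Vec ℕ n
  entries δ i S O f = tabulate λ q → entry δ i (lookup S q) (lookup O q) (lookup f q)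

  clamp : ∀ n → ℕ → Fin (suc n)
  clamp n       zero    = zero
  clamp zero    (suc j) = zero
  clamp (suc n) (suc j) = suc (clamp n j)

  toℕ-clamp : ∀ {n j} → j ≤ n → toℕ (clamp n j) ≡ j
  toℕ-clamp {n}     {zero}  _         = refl
  toℕ-clamp {suc n} {suc j} (s≤s j≤n) = cong suc (toℕ-clamp j≤n)

  -- The extra state records i: as the value δ + i + 1 at the front if i < rank f, and otherwise
  -- (then O = ∅) as the position of a new maximum.
  encodeRanking : ∀ {n} → Bool → Bool → Subset n → Subset n → Vec ℕ n → ℕ → Vec ℕ (suc n)
  encodeRanking     d true  S O f i = insertAt (entries (offset d) i S O f) zero (suc (offset d + i))
  encodeRanking {n} d false S O f i = insertAt (entries (offset d) i S O f) (clamp n ⌊ i /2⌋) (2 + offset d + rank f)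

  module _ {n} {S O : Subset n} {f : Vec ℕ n} {i : ℕ} (σ : Q₂Ranking S O f i) (d : Bool) (d≡ : d ≡ hasOutside S) where

    open Q₂Ranking σ

    private
      δ = offset d
      h = entries δ i S O f

    admissible : ∀ q → Admissible δ i (lookup S q) (lookup O q) (lookup f q)
    admissible q = inO , outS
      where
      inO : lookup O q ≡ true → lookup S q ≡ true × lookup f q ≡ i
      inO Oq with O-level q (lookup⇒[]= q O Oq)
      ... | q∈S , fq≡i = []=⇒lookup q∈S , fq≡i
      outS : lookup S q ≡ false → lookup f q ≡ 0 × δ ≡ 2
      outS Sq = outside-0 q q∉S , cong offset (trans d≡ (∉⇒hasOutside q∉S))
        where
        q∉S : q ∉ S
        q∉S q∈S with () ← trans (sym Sq) ([]=⇒lookup q∈S)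

    lookup-entries : ∀ q → lookup h q ≡ entry δ i (lookup S q) (lookup O q) (lookup f q)
    lookup-entries q = lookup∘tabulate _ q

    lookup-entries-odd : ∀ {q} → q ∈ S → Odd (lookup f q) → lookup h q ≡ δ + raiseAbove i (lookup f q)
    lookup-entries-odd {q} q∈S odd-fq =
      trans (lookup-entries q) (entry-member δ i (lookup f q) ([]=⇒lookup q∈S) (∉⇒lookup≡false q∉O))
      where
      q∉O : q ∉ O
      q∉O q∈O = Odd⇒≢Even odd-fq i-even (proj₂ (O-level q q∈O))

    member-hit : ∀ w → Odd w → w ≤ rank f → ∃[ q ] lookup h q ≡ δ + raiseAbove i w
    member-hit w odd-w w≤r with covers w odd-w w≤r
    ... | q , q∈S , refl = q , lookup-entries-odd q∈S odd-w

    member-hit-≤ : ∀ w → Odd w → w ≤ i → w ≤ rank f → ∃[ q ] lookup h q ≡ δ + w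
    member-hit-≤ w odd-w w≤i w≤r with member-hit w odd-w w≤r
    ... | q , eq = q , trans eq (cong (δ +_) (raiseAbove-≤ w≤i))

    -- With δ = 2 the value 1 is taken by a state outside S, which exists exactly then.
    low-hit : ∀ j → Odd j → j ≤ δ + i → j ≤ δ + rank f → ∃[ q ] lookup h q ≡ j
    low-hit j odd-j j≤δ+i j≤δ+r with offset-cases d d≡
    ... | inj₁ δ≡0 = subst (λ e → ∃[ q ] lookup h q ≡ e + j) δ≡0
                       (member-hit-≤ j odd-j (subst (λ e → j ≤ e + i) δ≡0 j≤δ+i) (subst (λ e → j ≤ e + rank f) δ≡0 j≤δ+r))
    ... | inj₂ (δ≡2 , q , q∉S) =
      hit j odd-j (subst (λ e → j ≤ e + i) δ≡2 j≤δ+i) (subst (λ e → j ≤ e + rank f) δ≡2 j≤δ+r)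
      where
      hit : ∀ j → Odd j → j ≤ 2 + i → j ≤ 2 + rank f → ∃[ q ] lookup h q ≡ j
      hit zero          odd-j _ _ = contradiction refl (Odd⇒≢0 odd-j)
      hit (suc zero)    _     _ _ = q , trans (lookup-entries q)
                                      (entry-outside δ i _ (∉⇒lookup≡false q∉S) (∉⇒lookup≡false (q∉S ∘ proj₁ ∘ O-level q)))
      hit (suc (suc w)) odd-j (s≤s (s≤s w≤i)) (s≤s (s≤s w≤r)) with member-hit-≤ w (Odd-+ˡ⁻ Even-2 odd-j) w≤i w≤r
      ... | q′ , eq = q′ , trans eq (cong (_+ w) δ≡2)

    Odd-δ+r : Odd (δ + rank f)
    Odd-δ+r = Odd-+ˡ (Even-offset d) rank-odd

    high-hit : ∀ j → Odd j → suc (δ + i) < j → j ≤ 2 + δ + rank f → ∃[ q ] lookup h q ≡ j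
    high-hit j odd-j x<j j≤m = q , trans hq≡ (sym j≡)
      where
      w = j ∸ (2 + δ)
      j≡ : j ≡ 2 + δ + w
      j≡ = sym (m+[n∸m]≡n (≤-trans (s≤s (s≤s (m≤m+n δ i))) x<j))
      odd-w : Odd w
      odd-w = Odd-+ˡ⁻ (∣m∣n⇒∣m+n Even-2 (Even-offset d)) (subst Odd j≡ odd-j)
      i<w : i < w
      i<w = ≤∧≢⇒< (+-cancelˡ-≤ (2 + δ) i w (subst (suc (δ + i) <_) j≡ x<j)) (λ i≡w → Odd⇒≢Even odd-w i-even (sym i≡w))
      w≤r : w ≤ rank f
      w≤r = +-cancelˡ-≤ (2 + δ) w (rank f) (subst (_≤ 2 + δ + rank f) j≡ j≤m)
      q = proj₁ (member-hit w odd-w w≤r)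
      hq≡ : lookup h q ≡ 2 + δ + w
      hq≡ = begin
        lookup h q         ≡⟨ proj₂ (member-hit w odd-w w≤r) ⟩
        δ + raiseAbove i w ≡⟨ cong (δ +_) (raiseAbove-> i<w) ⟩
        δ + (2 + w)        ≡⟨ +-assoc δ 2 w ⟨
        δ + 2 + w          ≡⟨ cong (_+ w) (+-comm δ 2) ⟩
        2 + δ + w          ∎
        where open ≡-Reasoning

    tight-below : i < rank f → IsTightFun (suc n) (encodeRanking d true S O f i)
    tight-below i<r = insertAt-tight h zero x m (Odd-+ˡ Even-2 Odd-δ+r) x≤m h≤m covered
      where
      x = suc (δ + i)
      m = 2 + δ + rank f
      δ+i≤δ+r = +-monoʳ-≤ δ (<⇒≤ i<r)
      x≤m : x ≤ m
      x≤m = s≤s (≤-trans δ+i≤δ+r (n≤1+n _))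
      h≤m : ∀ q → lookup h q ≤ m
      h≤m q = subst (_≤ m) (sym (lookup-entries q)) (entry-≤-below δ (lookup S q) (lookup O q) i<r (lookup≤rank f q))
      covered : ∀ j → Odd j → j ≤ m → j ≡ x ⊎ ∃[ q ] lookup h q ≡ j
      covered j odd-j j≤m with <-cmp j x
      ... | tri< j<x _ _ = inj₂ (low-hit j odd-j (≤-pred j<x) (≤-trans (≤-pred j<x) δ+i≤δ+r))
      ... | tri≈ _ j≡x _ = inj₁ j≡x
      ... | tri> _ _ x<j = inj₂ (high-hit j odd-j x<j j≤m)

    entries-<-above : rank f < i → ∀ q → lookup h q < 2 + δ + rank f
    entries-<-above r<i q = s≤s (≤-trans h≤δ+r (n≤1+n _))
      where
      h≤δ+r = subst (_≤ δ + rank f) (sym (lookup-entries q))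
        (entry-≤-above δ (lookup S q) (lookup O q) (admissible q) r<i (lookup≤rank f q) rank-odd)

    tight-above : rank f < i → IsTightFun (suc n) (encodeRanking d false S O f i)
    tight-above r<i = insertAt-tight h (clamp n ⌊ i /2⌋) x x (Odd-+ˡ Even-2 Odd-δ+r) ≤-refl (<⇒≤ ∘ entries-<-above r<i) covered
      where
      x = 2 + δ + rank f
      covered : ∀ j → Odd j → j ≤ x → j ≡ x ⊎ ∃[ q ] lookup h q ≡ j
      covered j odd-j j≤x with j ℕ.≟ x
      ... | yes j≡x = inj₁ j≡x
      ... | no  j≢x = inj₂ (low-hit j odd-j (≤-trans j≤δ+r (+-monoʳ-≤ δ (<⇒≤ r<i))) j≤δ+r)
        where
        j≤1+δ+r = ≤-pred (≤∧≢⇒< j≤x j≢x)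
        j≤δ+r = ≤-pred (≤∧≢⇒< j≤1+δ+r (λ j≡1+δ+r → ¬Odd∧Odd-suc Odd-δ+r (subst Odd j≡1+δ+r odd-j)))

    rank-encodeRanking-above : rank f < i → rank (encodeRanking d false S O f i) ≡ 2 + δ + rank f
    rank-encodeRanking-above r<i = rank-insertAt-max h (clamp n ⌊ i /2⌋) _ (<⇒≤ ∘ entries-<-above r<i)

    below-true : true ≡ (i <ᵇ rank f) → i < rank f
    below-true b≡ = <ᵇ⇒< i (rank f) (subst T b≡ _)

    below-false : false ≡ (i <ᵇ rank f) → rank f < i
    below-false b≡ = ≤∧≢⇒< (≮⇒≥ (λ i<r → subst T (sym b≡) (<⇒<ᵇ i<r))) (Odd⇒≢Even rank-odd i-even)

    encodeRanking-tight : ∀ b → b ≡ (i <ᵇ rank f) → IsTightFun (suc n) (encodeRanking d b S O f i)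
    encodeRanking-tight true  b≡ = tight-below (below-true b≡)
    encodeRanking-tight false b≡ = tight-above (below-false b≡)

    ⌊i/2⌋≤n : ⌊ i /2⌋ ≤ n
    ⌊i/2⌋≤n = ≤-trans (⌊n/2⌋-mono (≤-trans (m≤m+n i 2) i-bound)) (≤-reflexive (sym (n≡⌊n+n/2⌋ n)))

  entries-injective : ∀ {n δ i} {S O S′ O′ : Subset n} {f f′ : Vec ℕ n} →
                      (∀ q → Admissible δ i (lookup S q) (lookup O q) (lookup f q)) →
                      (∀ q → Admissible δ i (lookup S′ q) (lookup O′ q) (lookup f′ q)) →
                      entries δ i S O f ≡ entries δ i S′ O′ f′ → S ≡ S′ × O ≡ O′ × f ≡ f′
  entries-injective {S = S} {O} {S′} {O′} {f} {f′} adm adm′ eq =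
    lookup-extensionality (proj₁ ∘ agree) ,
    lookup-extensionality (proj₁ ∘ proj₂ ∘ agree) ,
    lookup-extensionality (proj₂ ∘ proj₂ ∘ agree)
    where
    agree : ∀ q → lookup S q ≡ lookup S′ q × lookup O q ≡ lookup O′ q × lookup f q ≡ lookup f′ q
    agree q = entry-injective (adm q) (adm′ q)
      (trans (sym (lookup∘tabulate _ q)) (trans (cong (λ h → lookup h q) eq) (lookup∘tabulate _ q)))

  module _ {n} {S O S′ O′ : Subset n} {f f′ : Vec ℕ n} {i i′ : ℕ} (σ : Q₂Ranking S O f i) (σ′ : Q₂Ranking S′ O′ f′ i′)
           (d : Bool) (d≡ : d ≡ hasOutside S) (d≡′ : d ≡ hasOutside S′) where

    private
      δ = offset d

      entries-injective′ : i ≡ i′ → entries δ i S O f ≡ entries δ i′ S′ O′ f′ →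
                           S ≡ S′ × O ≡ O′ × f ≡ f′ × i ≡ i′
      entries-injective′ refl eq with entries-injective (admissible σ d d≡) (admissible σ′ d d≡′) eq
      ... | S≡S′ , O≡O′ , f≡f′ = S≡S′ , O≡O′ , f≡f′ , refl

    encodeRanking-injective-below : encodeRanking d true S O f i ≡ encodeRanking d true S′ O′ f′ i′ →
                                    S ≡ S′ × O ≡ O′ × f ≡ f′ × i ≡ i′
    encodeRanking-injective-below eq with ∷-injective eq
    ... | head≡ , tail≡ = entries-injective′ (+-cancelˡ-≡ δ i i′ (suc-injective head≡)) tail≡

    -- The new maximum 2 + δ + rank f is found again by its size, and its position gives ⌊ i /2⌋.
    encodeRanking-injective-above : rank f < i → rank f′ < i′ →
                                    encodeRanking d false S O f i ≡ encodeRanking d false S′ O′ f′ i′ →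
                                    S ≡ S′ × O ≡ O′ × f ≡ f′ × i ≡ i′
    encodeRanking-injective-above r<i r′<i′ eq = entries-injective′ i≡i′ (proj₂ same-insertion)
      where
      p  = clamp n ⌊ i /2⌋
      p′ = clamp n ⌊ i′ /2⌋
      r≡r′ : rank f ≡ rank f′
      r≡r′ = +-cancelˡ-≡ (2 + δ) _ _ (begin
        2 + δ + rank f                                 ≡⟨ rank-encodeRanking-above σ d d≡ r<i ⟨
        rank (encodeRanking d false S O f i)           ≡⟨ cong rank eq ⟩
        rank (encodeRanking d false S′ O′ f′ i′)       ≡⟨ rank-encodeRanking-above σ′ d d≡′ r′<i′ ⟩
        2 + δ + rank f′                                ∎)
        where open ≡-Reasoning
      same-insertion = insertAt-injective-max (entries δ i S O f) (entries δ i′ S′ O′ f′) p p′ (2 + δ + rank f)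
        (λ q → subst (λ r → _ < 2 + δ + r) (sym r≡r′) (entries-<-above σ′ d d≡′ r′<i′ q))
        (subst (λ r → encodeRanking d false S O f i ≡ insertAt (entries δ i′ S′ O′ f′) p′ (2 + δ + r)) (sym r≡r′) eq)
      i≡i′ : i ≡ i′
      i≡i′ = ⌊/2⌋-injective-Even (Q₂Ranking.i-even σ) (Q₂Ranking.i-even σ′) (begin
        ⌊ i /2⌋   ≡⟨ toℕ-clamp (⌊i/2⌋≤n σ d d≡) ⟨
        toℕ p     ≡⟨ cong toℕ (proj₁ same-insertion) ⟩
        toℕ p′    ≡⟨ toℕ-clamp (⌊i/2⌋≤n σ′ d d≡′) ⟩
        ⌊ i′ /2⌋  ∎)
        where open ≡-Reasoning

    encodeRanking-injective : ∀ b → b ≡ (i <ᵇ rank f) → b ≡ (i′ <ᵇ rank f′) →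
                              encodeRanking d b S O f i ≡ encodeRanking d b S′ O′ f′ i′ →
                              S ≡ S′ × O ≡ O′ × f ≡ f′ × i ≡ i′
    encodeRanking-injective true  _  _   = encodeRanking-injective-below
    encodeRanking-injective false b≡ b≡′ = encodeRanking-injective-above (below-false σ d d≡ b≡) (below-false σ′ d d≡′ b≡′)

  flagsOf : ∀ {n} → Subset n → Vec ℕ n → ℕ → Bool × Bool
  flagsOf S f i = hasOutside S , (i <ᵇ rank f)

  encodeQ₂ : ∀ {n} → Subset n → Subset n → Vec ℕ n → ℕ → Vec ℕ (suc n)
  encodeQ₂ S O f i = encodeRanking (hasOutside S) (i <ᵇ rank f) S O f i

  encodeQ₂-tight : ∀ {n} {S O : Subset n} {f i} → Q₂Ranking S O f i → IsTightFun (suc n) (encodeQ₂ S O f i)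
  encodeQ₂-tight σ = encodeRanking-tight σ _ refl _ refl

  encodeQ₂-injective : ∀ {n} {S O S′ O′ : Subset n} {f f′ i i′} → Q₂Ranking S O f i → Q₂Ranking S′ O′ f′ i′ →
                       flagsOf S f i ≡ flagsOf S′ f′ i′ → encodeQ₂ S O f i ≡ encodeQ₂ S′ O′ f′ i′ →
                       S ≡ S′ × O ≡ O′ × f ≡ f′ × i ≡ i′
  encodeQ₂-injective {S = S} {O} {S′} {O′} {f} {f′} {i} {i′} σ σ′ flags≡ eq =
    encodeRanking-injective σ σ′ _ refl (cong proj₁ flags≡) _ refl (cong proj₂ flags≡)
      (subst₂ (λ d b → encodeQ₂ S O f i ≡ encodeRanking d b S′ O′ f′ i′)
              (sym (cong proj₁ flags≡)) (sym (cong proj₂ flags≡)) eq)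

module StateCount where

  open import Data.Nat using (zero; suc; _^_; z≤n; s≤s; ⌊_/2⌋)
  open import Data.Nat.Properties using (≤-refl; +-comm)
  open import Data.Bool using (Bool; true; false)
  open import Data.Maybe using (Maybe; just; nothing)
  open import Data.Maybe.Properties using (just-injective)
  open import Data.Fin using (zero)
  open import Data.Fin.Subset using (_⊆_; ⊥)
  open import Data.List using (List; []; _∷_; length; cartesianProduct)
  open import Data.List.Membership.Propositional using (_∈_)
  open import Data.List.Membership.Propositional.Properties using (∈-cartesianProduct⁺)
  open import Data.List.Relation.Unary.Any using (here; there)
  open import Data.Vec as Vec using (Vec; _∷_; map; cast)
  open import Data.Vec.Properties using (∷-injective; lookup-map)
  open import Data.Vec.Relation.Unary.All as VecAll using ([]; _∷_)
  open import Data.Product using (_,_; proj₁; proj₂)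
  open import Data.Sum using (_⊎_; inj₁; inj₂)
  open import Data.Unit using (⊤)
  open import Function using (_∘_)
  open import Relation.Binary.PropositionalEquality
  open import Relation.Nullary using (contradiction)
  open Enumeration
  open SymmetricChains
  open Parity
  open TightFunctions
  open RankingCode

  IsMin-antichain : ∀ {k} {φ : PForm k} {M M′ : Subset k} → IsMin φ M → IsMin φ M′ → M ⊆ M′ → M ≡ M′
  IsMin-antichain (satM , _) (_ , minM′) M⊆M′ = minM′ _ M⊆M′ satM

  middle-injective-Min : ∀ {k} {φ : PForm k} {M M′ : Subset k} → IsMin φ M → IsMin φ M′ → middle M ≡ middle M′ → M ≡ M′
  middle-injective-Min {M = M} {M′} minM minM′ eq with middle-comparable M M′ eq
  ... | inj₁ M⊆M′ = IsMin-antichain minM minM′ M⊆M′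
  ... | inj₂ M′⊆M = sym (IsMin-antichain minM′ minM M′⊆M)

  map-injective-on : ∀ {A B : Set} {P : A → Set} {f : A → B} → (∀ {x y} → P x → P y → f x ≡ f y → x ≡ y) →
                     ∀ {n} {u v : Vec A n} → VecAll.All P u → VecAll.All P v → map f u ≡ map f v → u ≡ v
  map-injective-on f-inj []         []         _  = refl
  map-injective-on f-inj (px ∷ pu) (py ∷ pv) eq with ∷-injective eq
  ... | fx≡fy , fu≡fv = cong₂ _∷_ (f-inj px py fx≡fy) (map-injective-on f-inj pu pv fu≡fv)

  middles∈vectors : ∀ {k n} (μ : Vec (Subset k) n) → map middle μ ∈ vectors n (layer k ⌊ k /2⌋)
  middles∈vectors μ = ∈-vectors (go μ)
    where
    go : ∀ {m} (ν : Vec _ m) → VecAll.All (_∈ layer _ ⌊ _ /2⌋) (map middle ν)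
    go Vec.[]  = []
    go (M ∷ ν) = middle∈layer M ∷ go ν

  indicator : Bool → ℕ
  indicator true  = 1
  indicator false = 0

  indicator-injective : ∀ {a b} → indicator a ≡ indicator b → a ≡ b
  indicator-injective {true}  {true}  _ = refl
  indicator-injective {false} {false} _ = refl

  encodeSubset : ∀ {n} → Subset n → Vec ℕ (suc n)
  encodeSubset S = 1 ∷ map indicator S

  encodeSubset-tight : ∀ {n} (S : Subset n) → IsTightFun (suc n) (encodeSubset S)
  encodeSubset-tight S = insertAt-tight (map indicator S) zero 1 1 Odd-1 ≤-refl χ≤1 covered
    where
    χ≤1 : ∀ q → Vec.lookup (map indicator S) q ≤ 1
    χ≤1 q rewrite lookup-map q indicator S = indicator≤1 (Vec.lookup S q)
      where
      indicator≤1 : ∀ b → indicator b ≤ 1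
      indicator≤1 true  = ≤-refl
      indicator≤1 false = z≤n
    covered : ∀ j → Odd j → j ≤ 1 → j ≡ 1 ⊎ ∃[ q ] Vec.lookup (map indicator S) q ≡ j
    covered zero          odd-j _ = contradiction refl (Odd⇒≢0 odd-j)
    covered (suc zero)    _     _ = inj₁ refl
    covered (suc (suc j)) _     (s≤s ())

  Code : ℕ → ℕ → Set
  Code n k = Maybe (Bool × Bool) × Vec (Subset k) n × Vec ℕ (n + 1)

  -- nothing marks a state S ∈ 2^Q; the second component is junk there.
  code : ∀ {n k} → RawState n k → Code n k
  code {n} (inj₁ S) = nothing , map middle (Vec.replicate n ⊥) , cast (+-comm 1 n) (encodeSubset S)
  code {n} (inj₂ (S , O , f , i , μ)) =
    just (flagsOf S f i) , map middle μ , cast (+-comm 1 n) (encodeQ₂ S O f i)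

  module _ {n k : ℕ} (A : InfTELA n k) (L : Subset k) where

    Q₂Ranking-of-state : ∀ {S O f i μ} → IsStateB A L (inj₂ (S , O , f , i , μ)) → Q₂Ranking S O f i
    Q₂Ranking-of-state (_ , _ , (rank-odd , covers , outside-0 , _) , (i-even , i-bound) , O-level) =
      record { rank-odd = rank-odd ; covers = covers ; outside-0 = outside-0
             ; i-even = i-even ; i-bound = i-bound ; O-level = O-level }

    code-injective : ∀ {x y} → IsStateB A L x → IsStateB A L y → code x ≡ code y → x ≡ y
    code-injective {inj₁ S} {inj₁ S′} _ _ eq =
      cong inj₁ (map-injective-on {P = λ _ → ⊤} (λ _ _ → indicator-injective) (VecAll.universal _ S) (VecAll.universal _ S′)
                   (proj₂ (∷-injective (cast-injective (+-comm 1 n) (cong (proj₂ ∘ proj₂) eq)))))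
    code-injective {inj₁ _} {inj₂ _} _ _ ()
    code-injective {inj₂ _} {inj₁ _} _ _ ()
    code-injective {inj₂ (S , O , f , i , μ)} {inj₂ (S′ , O′ , f′ , i′ , μ′)} state state′ eq
      with encodeQ₂-injective (Q₂Ranking-of-state state) (Q₂Ranking-of-state state′)
             (just-injective (cong proj₁ eq)) (cast-injective (+-comm 1 n) (cong (proj₂ ∘ proj₂) eq))
    ... | refl , refl , refl , refl = cong (λ μ → inj₂ (S , O , f , i , μ))
            (map-injective-on {P = IsMin (negAccOf A)} middle-injective-Min (proj₁ state) (proj₁ state′) (cong (proj₁ ∘ proj₂) eq))

  flags : List (Maybe (Bool × Bool))
  flags = nothing ∷ just (true , true) ∷ just (true , false) ∷ just (false , true) ∷ just (false , false) ∷ []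

  ∈-flags : ∀ b → b ∈ flags
  ∈-flags nothing                = here refl
  ∈-flags (just (true  , true))  = there (here refl)
  ∈-flags (just (true  , false)) = there (there (here refl))
  ∈-flags (just (false , true))  = there (there (there (here refl)))
  ∈-flags (just (false , false)) = there (there (there (there (here refl))))

  module _ {n k : ℕ} (A : InfTELA n k) (L : Subset k) {m t : ℕ} (states : NumStatesB A L m) (tight : Tight (n + 1) t) where

    middleVectors : List (Vec (Subset k) n)
    middleVectors = vectors n (layer k ⌊ k /2⌋)

    tightFunctions : List (Vec ℕ (n + 1))
    tightFunctions = HasCard.xs tight

    codes : List (Code n k)
    codes = cartesianProduct flags (cartesianProduct middleVectors tightFunctions)

    length-codes : length codes ≡ 5 * bound n k t
    length-codes = begin
      length codes
        ≡⟨ length-cartesianProduct flags (cartesianProduct middleVectors tightFunctions) ⟩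
      5 * length (cartesianProduct middleVectors tightFunctions)
        ≡⟨ cong (5 *_) (length-cartesianProduct middleVectors tightFunctions) ⟩
      5 * (length middleVectors * length tightFunctions)
        ≡⟨ cong₂ (λ v l → 5 * (v * l)) (length-vectors n (layer k ⌊ k /2⌋)) (HasCard.len tight) ⟩
      5 * (length (layer k ⌊ k /2⌋) ^ n * t)
        ≡⟨ cong (λ c → 5 * (c ^ n * t)) (length-layer k ⌊ k /2⌋) ⟩
      5 * bound n k t
        ∎
      where open ≡-Reasoning

    in-codes : ∀ {b μ g} → IsTightFun (suc n) g → (b , map middle μ , cast (+-comm 1 n) g) ∈ codes
    in-codes g-tight = ∈-cartesianProduct⁺ (∈-flags _)
      (∈-cartesianProduct⁺ (middles∈vectors _) (HasCard.complete tight _ (cast-tight (+-comm 1 n) g-tight)))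

    code∈codes : ∀ x → IsStateB A L x → code x ∈ codes
    code∈codes (inj₁ S) _ = in-codes (encodeSubset-tight S)
    code∈codes (inj₂ (S , O , f , i , μ)) state = in-codes (encodeQ₂-tight (Q₂Ranking-of-state A L state))

    states-≤ : m ≤ 5 * bound n k t
    states-≤ = subst (m ≤_) length-codes (HasCard-≤-injection (IsStateB A L) code (code-injective A L) states code∈codes)

open StateCount using (states-≤)

corollary2 : ∃[ c ] ∃[ N ] (∀ (n k : ℕ) → n ≥ N → (A : InfTELA n k) → (L : Subset k)
    → IsLex (negAccOf A) L → (m t : ℕ) → NumStatesB A L m → Tight (n + 1) t
    → m ≤ c * bound n k t)
corollary2 = 5 , 0 , λ n k _ A L _ m t states tight → states-≤ A L states tight
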